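{- Let $\vec G=(G_0,\dots,G_n)$ be a wfgv. Then $\vec G$ is weakly constant if and only if $\vec G$ is weakly compact.
   Context: Untyped $\lambda$-calculus; $=$ denotes $\beta$-conversion. $M\vec G=MG_0\cdots G_n$; $F^k(z)=F(F(\cdots F(z)\cdots))$ with $k$ copies of $F$. $M=^\infty N$ means $M$ and $N$ have the same Böhm tree. $Y$ is a wfpc if $Yx=^\infty x(Yx)$ for $x$ not free in $Y$; $\mathsf{WFPC}$ is the set of wfpcs. $\vec G$ is a wfgv if $Y\in\mathsf{WFPC}\Rightarrow Y\vec G\in\mathsf{WFPC}$. Write $z\notin^\infty M$ if some $N=^\infty M$ has $z$ not free in $N$. Fix a variable $z$ not free in $\vec G$. $\vec G$ is weakly constant if there is $k\ge0$ with $z\notin^\infty G_0^k(z)G_1\cdots G_n$, and weakly compact if there is $k\ge0$ with $G_0^k(z)G_1\cdots G_n\in\mathsf{WFPC}$. -}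

module Defs where

open import Data.Nat using (ℕ; zero; suc)
open import Data.List using (List; []; _∷_; foldl)
open import Data.List.Relation.Binary.Pointwise using (Pointwise)
open import Data.List.Relation.Unary.All using (All)
open import Data.Product using (Σ; _×_; _,_; ∃)
open import Data.Sum using (_⊎_)
open import Data.Unit using (⊤)
open import Relation.Nullary using (¬_)
open import Relation.Binary.PropositionalEquality using (_≡_)
open import Relation.Binary.Construct.Closure.ReflexiveTransitive using (Star)

-- Untyped λ-terms, de Bruijn indices (free variables = indices not
-- bound by an enclosing λ).

infixl 7 _·_

data Λ : Set where
  var : ℕ → Λ
  _·_ : Λ → Λ → Λ
  lam : Λ → Λ

ext : (ℕ → ℕ) → ℕ → ℕ
ext ρ zero    = zero
ext ρ (suc n) = suc (ρ n)

ren : (ℕ → ℕ) → Λ → Λ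
ren ρ (var x) = var (ρ x)
ren ρ (M · N) = ren ρ M · ren ρ N
ren ρ (lam M) = lam (ren (ext ρ) M)

exts : (ℕ → Λ) → ℕ → Λ
exts σ zero    = var zero
exts σ (suc n) = ren suc (σ n)

sub : (ℕ → Λ) → Λ → Λ
sub σ (var x) = σ x
sub σ (M · N) = sub σ M · sub σ N
sub σ (lam M) = lam (sub (exts σ) M)

single : Λ → ℕ → Λ
single N zero    = N
single N (suc n) = var n

_[_] : Λ → Λ → Λ
M [ N ] = sub (single N) M

infix 4 _⟶_ _↠_
data _⟶_ : Λ → Λ → Set where
  β    : ∀ {M N} → lam M · N ⟶ M [ N ]
  appL : ∀ {M M′ N} → M ⟶ M′ → M · N ⟶ M′ · N
  appR : ∀ {M N N′} → N ⟶ N′ → M · N ⟶ M · N′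
  ξ    : ∀ {M M′} → M ⟶ M′ → lam M ⟶ lam M′

_↠_ : Λ → Λ → Set
_↠_ = Star _⟶_

apps : Λ → List Λ → Λ
apps = foldl _·_

lams : ℕ → Λ → Λ
lams zero    M = M
lams (suc n) M = lam (lams n M)

HasHnf : Λ → Set
HasHnf M = Σ ℕ λ n → Σ ℕ λ h → Σ (List Λ) λ Ms → M ↠ lams n (apps (var h) Ms)

-- Böhm-tree equality, via agreement of the Böhm trees up to every
-- finite depth k.

BTeq : ℕ → Λ → Λ → Set
BTeq zero    M N = ⊤
BTeq (suc k) M N =
  (¬ HasHnf M × ¬ HasHnf N)
  ⊎ (Σ ℕ λ n → Σ ℕ λ h → Σ (List Λ) λ Ms → Σ (List Λ) λ Ns →
       (M ↠ lams n (apps (var h) Ms)) × (N ↠ lams n (apps (var h) Ns))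
       × Pointwise (BTeq k) Ms Ns)

infix 4 _=∞_
_=∞_ : Λ → Λ → Set
M =∞ N = ∀ k → BTeq k M N

data FreeIn (x : ℕ) : Λ → Set where
  fvar  : ∀ {y} → x ≡ y → FreeIn x (var y)
  fappL : ∀ {M N} → FreeIn x M → FreeIn x (M · N)
  fappR : ∀ {M N} → FreeIn x N → FreeIn x (M · N)
  flam  : ∀ {M} → FreeIn (suc x) M → FreeIn x (lam M)

_∉∞_ : ℕ → Λ → Set
z ∉∞ M = Σ Λ λ N → N =∞ M × ¬ FreeIn z N

IsWFPC : Λ → Set
IsWFPC Y = ∀ x → ¬ FreeIn x Y → Y · var x =∞ var x · (Y · var x)

-- a vector G⃗ = (G₀ , G₁ ... Gₙ) is given as G₀ and the list [G₁ ... Gₙ]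
IsWFGV : Λ → List Λ → Set
IsWFGV G₀ Gs = ∀ Y → IsWFPC Y → IsWFPC (apps Y (G₀ ∷ Gs))

iter : Λ → ℕ → Λ → Λ
iter F zero    z = z
iter F (suc k) z = F · iter F k z

WeaklyConstant : ℕ → Λ → List Λ → Set
WeaklyConstant z G₀ Gs = Σ ℕ λ k → z ∉∞ apps (iter G₀ k (var z)) Gs

WeaklyCompact : ℕ → Λ → List Λ → Set
WeaklyCompact z G₀ Gs = Σ ℕ λ k → IsWFPC (apps (iter G₀ k (var z)) Gs)

module Submission where

open import Defs
open import Data.Empty using (⊥-elim)
open import Data.List using (List; []; _∷_; map; _++_; length)
open import Data.List.Relation.Binary.Pointwise using (Pointwise; []; _∷_; ++⁺)
import Data.List.Relation.Binary.Pointwise as Pw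
open import Data.List.Relation.Unary.All using (All; []; _∷_)
import Data.List.Relation.Unary.All as All
open import Data.List.Properties using (map-id-local)
open import Data.Nat using (ℕ; zero; suc; _+_; _<_; s≤s; _⊔_; pred; _≟_)
open import Data.Nat.Properties
  using (<-irrefl; ≤-refl; ≤-trans; m≤m⊔n; m≤n⊔m; +-identityʳ; +-suc; suc-injective)
open import Data.Product using (Σ; _×_; _,_; proj₁; proj₂)
open import Data.Sum using (_⊎_; inj₁; inj₂)
open import Data.Unit using (⊤; tt)
open import Function using (_∘_)
open import Function.Bundles using (_⇔_; mk⇔)
open import Relation.Binary.Construct.Closure.ReflexiveTransitive using (Star; ε; _◅_; _◅◅_)
open import Relation.Binary.PropositionalEquality
  using (_≡_; _≢_; _≗_; refl; sym; trans; cong; cong₂; subst; subst₂)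
open import Relation.Nullary using (¬_; yes; no)

{-
The combinator Θ = A₀A₀, A₀ = λab.b(aab), satisfies Θx ↠ x(Θx), so Θ is a
wfpc.  For any wfpc Y and fresh x, unfolding Yx =∞ x(Yx) shows that Yx has
the Böhm tree x(x(x⋯)); hence Y ↠ λQ and Y has the Böhm tree λx.x(x(x⋯)) of
the closed term Θ.  So weakly compact vectors are weakly constant.

For the other direction let A = G₀ᵏ(z)G₁⋯Gₙ =∞ N with z not free in N.
Böhm-tree equality to N survives any substitution for z (an unsolvable
term stays unsolvable under substitution, by standardisation), so
A[z := ΘG₀] =∞ N =∞ A.  But A[z := ΘG₀] = G₀ᵏ(ΘG₀)G₁⋯Gₙ is a reduct of
ΘG₀G₁⋯Gₙ, a wfpc because G⃗ is a wfgv; so A is a wfpc.  The case k = 0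
is excluded, since z is the head variable of zG₁⋯Gₙ.
-}

-- Renaming and substitution

ext-cong : ∀ {ρ ρ′} → ρ ≗ ρ′ → ext ρ ≗ ext ρ′
ext-cong e zero    = refl
ext-cong e (suc n) = cong suc (e n)

ren-cong : ∀ {ρ ρ′} → ρ ≗ ρ′ → ∀ M → ren ρ M ≡ ren ρ′ M
ren-cong e (var x) = cong var (e x)
ren-cong e (M · N) = cong₂ _·_ (ren-cong e M) (ren-cong e N)
ren-cong e (lam M) = cong lam (ren-cong (ext-cong e) M)

exts-cong : ∀ {σ τ} → σ ≗ τ → exts σ ≗ exts τ
exts-cong e zero    = refl
exts-cong e (suc n) = cong (ren suc) (e n)

sub-cong : ∀ {σ τ} → σ ≗ τ → ∀ M → sub σ M ≡ sub τ M
sub-cong e (var x) = e x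
sub-cong e (M · N) = cong₂ _·_ (sub-cong e M) (sub-cong e N)
sub-cong e (lam M) = cong lam (sub-cong (exts-cong e) M)

ren-ren : ∀ ρ ρ′ M → ren ρ (ren ρ′ M) ≡ ren (ρ ∘ ρ′) M
ren-ren ρ ρ′ (var x) = refl
ren-ren ρ ρ′ (M · N) = cong₂ _·_ (ren-ren ρ ρ′ M) (ren-ren ρ ρ′ N)
ren-ren ρ ρ′ (lam M) = cong lam (trans (ren-ren (ext ρ) (ext ρ′) M)
  (ren-cong (λ { zero → refl ; (suc n) → refl }) M))

ren-sub : ∀ σ ρ M → sub σ (ren ρ M) ≡ sub (σ ∘ ρ) M
ren-sub σ ρ (var x) = refl
ren-sub σ ρ (M · N) = cong₂ _·_ (ren-sub σ ρ M) (ren-sub σ ρ N)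
ren-sub σ ρ (lam M) = cong lam (trans (ren-sub (exts σ) (ext ρ) M)
  (sub-cong (λ { zero → refl ; (suc n) → refl }) M))

sub-ren : ∀ ρ σ M → ren ρ (sub σ M) ≡ sub (ren ρ ∘ σ) M
sub-ren ρ σ (var x) = refl
sub-ren ρ σ (M · N) = cong₂ _·_ (sub-ren ρ σ M) (sub-ren ρ σ N)
sub-ren ρ σ (lam M) = cong lam (trans (sub-ren (ext ρ) (exts σ) M)
  (sub-cong (λ { zero → refl
               ; (suc n) → trans (ren-ren (ext ρ) suc (σ n)) (sym (ren-ren suc ρ (σ n))) }) M))

sub-sub : ∀ σ τ M → sub σ (sub τ M) ≡ sub (sub σ ∘ τ) M
sub-sub σ τ (var x) = refl
sub-sub σ τ (M · N) = cong₂ _·_ (sub-sub σ τ M) (sub-sub σ τ N)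
sub-sub σ τ (lam M) = cong lam (trans (sub-sub (exts σ) (exts τ) M)
  (sub-cong (λ { zero → refl
               ; (suc n) → trans (ren-sub (exts σ) suc (τ n)) (sym (sub-ren suc σ (τ n))) }) M))

sub-id : ∀ M → sub var M ≡ M
sub-id (var x) = refl
sub-id (M · N) = cong₂ _·_ (sub-id M) (sub-id N)
sub-id (lam M) = cong lam (trans (sub-cong (λ { zero → refl ; (suc n) → refl }) M) (sub-id M))

ren≡sub : ∀ ρ M → ren ρ M ≡ sub (var ∘ ρ) M
ren≡sub ρ (var x) = refl
ren≡sub ρ (M · N) = cong₂ _·_ (ren≡sub ρ M) (ren≡sub ρ N)
ren≡sub ρ (lam M) = cong lam (trans (ren≡sub (ext ρ) M)
  (sub-cong (λ { zero → refl ; (suc n) → refl }) M))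

sub-[] : ∀ σ M N → sub σ (M [ N ]) ≡ sub (exts σ) M [ sub σ N ]
sub-[] σ M N = trans (sub-sub σ (single N) M)
  (trans (sub-cong (λ { zero → refl
                      ; (suc n) → sym (trans (ren-sub (single (sub σ N)) suc (σ n)) (sub-id (σ n))) }) M)
    (sym (sub-sub (single (sub σ N)) (exts σ) M)))

ren-[] : ∀ ρ M N → ren ρ (M [ N ]) ≡ ren (ext ρ) M [ ren ρ N ]
ren-[] ρ M N = trans (ren≡sub ρ (M [ N ]))
  (trans (sub-[] (var ∘ ρ) M N)
   (sym (cong₂ _[_] (trans (ren≡sub (ext ρ) M) (sub-cong (λ { zero → refl ; (suc n) → refl }) M))
                    (ren≡sub ρ N))))

extsⁿ : ℕ → (ℕ → Λ) → ℕ → Λ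
extsⁿ zero    σ = σ
extsⁿ (suc n) σ = extsⁿ n (exts σ)

sub-lams : ∀ σ n M → sub σ (lams n M) ≡ lams n (sub (extsⁿ n σ) M)
sub-lams σ zero    M = refl
sub-lams σ (suc n) M = cong lam (sub-lams (exts σ) n M)

sub-apps : ∀ σ M Ms → sub σ (apps M Ms) ≡ apps (sub σ M) (map (sub σ) Ms)
sub-apps σ M []       = refl
sub-apps σ M (N ∷ Ms) = sub-apps σ (M · N) Ms

sub-hnf : ∀ σ n h Ms {v} → extsⁿ n σ h ≡ var v →
  sub σ (lams n (apps (var h) Ms)) ≡ lams n (apps (var v) (map (sub (extsⁿ n σ)) Ms))
sub-hnf σ n h Ms e = trans (sub-lams σ n _)
  (cong (lams n) (trans (sub-apps (extsⁿ n σ) (var h) Ms) (cong (λ H → apps H (map (sub (extsⁿ n σ)) Ms)) e)))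

apps-∷ʳ : ∀ M Ms N → apps M (Ms ++ N ∷ []) ≡ apps M Ms · N
apps-∷ʳ M []       N = refl
apps-∷ʳ M (P ∷ Ms) N = apps-∷ʳ (M · P) Ms N

FreeIn-ren : ∀ {y} ρ M → FreeIn y (ren ρ M) → Σ ℕ λ v → FreeIn v M × ρ v ≡ y
FreeIn-ren ρ (var x) (fvar e) = x , fvar refl , sym e
FreeIn-ren ρ (M · N) (fappL f) with FreeIn-ren ρ M f
... | v , g , e = v , fappL g , e
FreeIn-ren ρ (M · N) (fappR f) with FreeIn-ren ρ N f
... | v , g , e = v , fappR g , e
FreeIn-ren ρ (lam M) (flam f) with FreeIn-ren (ext ρ) M f
... | zero  , g , ()
... | suc v , g , e = v , flam g , suc-injective e

FreeIn-sub : ∀ {y} σ M → FreeIn y (sub σ M) → Σ ℕ λ v → FreeIn v M × FreeIn y (σ v)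
FreeIn-sub σ (var x) f = x , fvar refl , f
FreeIn-sub σ (M · N) (fappL f) with FreeIn-sub σ M f
... | v , g , e = v , fappL g , e
FreeIn-sub σ (M · N) (fappR f) with FreeIn-sub σ N f
... | v , g , e = v , fappR g , e
FreeIn-sub σ (lam M) (flam f) with FreeIn-sub (exts σ) M f
... | zero  , g , fvar ()
... | suc v , g , e with FreeIn-ren suc (σ v) e
... | w , h , refl = v , flam g , h

sub-cong-FreeIn : ∀ {σ τ} M → (∀ y → FreeIn y M → σ y ≡ τ y) → sub σ M ≡ sub τ M
sub-cong-FreeIn (var x) e = e x (fvar refl)
sub-cong-FreeIn (M · N) e =
  cong₂ _·_ (sub-cong-FreeIn M (λ y → e y ∘ fappL)) (sub-cong-FreeIn N (λ y → e y ∘ fappR))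
sub-cong-FreeIn (lam M) e =
  cong lam (sub-cong-FreeIn M (λ { zero f → refl ; (suc y) f → cong (ren suc) (e y (flam f)) }))

FreeIn-lams : ∀ n {z M} → FreeIn (n + z) M → FreeIn z (lams n M)
FreeIn-lams zero    f = f
FreeIn-lams (suc n) {z} {M} f = flam (FreeIn-lams n (subst (λ w → FreeIn w M) (sym (+-suc n z)) f))

¬FreeIn-apps⁻ : ∀ {y} M Ms → ¬ FreeIn y (apps M Ms) → ¬ FreeIn y M × All (λ N → ¬ FreeIn y N) Ms
¬FreeIn-apps⁻ M []       y∉ = y∉ , []
¬FreeIn-apps⁻ M (N ∷ Ms) y∉ with ¬FreeIn-apps⁻ (M · N) Ms y∉
... | y∉MN , y∉Ms = y∉MN ∘ fappL , (y∉MN ∘ fappR) ∷ y∉Ms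

¬FreeIn-apps⁺ : ∀ {y} M Ms → ¬ FreeIn y M → All (λ N → ¬ FreeIn y N) Ms → ¬ FreeIn y (apps M Ms)
¬FreeIn-apps⁺ M []       y∉M []            = y∉M
¬FreeIn-apps⁺ M (N ∷ Ms) y∉M (y∉N ∷ y∉Ms) =
  ¬FreeIn-apps⁺ (M · N) Ms (λ { (fappL f) → y∉M f ; (fappR f) → y∉N f }) y∉Ms

appL* : ∀ {M M′ N} → M ↠ M′ → M · N ↠ M′ · N
appL* ε       = ε
appL* (s ◅ r) = appL s ◅ appL* r

appR* : ∀ {M N N′} → N ↠ N′ → M · N ↠ M · N′
appR* ε       = ε
appR* (s ◅ r) = appR s ◅ appR* r

ξ* : ∀ {M M′} → M ↠ M′ → lam M ↠ lam M′
ξ* ε       = ε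
ξ* (s ◅ r) = ξ s ◅ ξ* r

apps* : ∀ {M M′} Ms → M ↠ M′ → apps M Ms ↠ apps M′ Ms
apps* []       r = r
apps* (N ∷ Ms) r = apps* Ms (appL* r)

sub-⟶ : ∀ σ {M M′} → M ⟶ M′ → sub σ M ⟶ sub σ M′
sub-⟶ σ (β {M} {N}) = subst (sub σ (lam M · N) ⟶_) (sym (sub-[] σ M N)) β
sub-⟶ σ (appL s)    = appL (sub-⟶ σ s)
sub-⟶ σ (appR s)    = appR (sub-⟶ σ s)
sub-⟶ σ (ξ s)       = ξ (sub-⟶ (exts σ) s)

sub-↠ : ∀ σ {M M′} → M ↠ M′ → sub σ M ↠ sub σ M′
sub-↠ σ ε       = ε
sub-↠ σ (s ◅ r) = sub-⟶ σ s ◅ sub-↠ σ r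

ren-↠ : ∀ ρ {M M′} → M ↠ M′ → ren ρ M ↠ ren ρ M′
ren-↠ ρ {M} {M′} r = subst₂ _↠_ (sym (ren≡sub ρ M)) (sym (ren≡sub ρ M′)) (sub-↠ (var ∘ ρ) r)

FreeIn-⟶ : ∀ {y M M′} → M ⟶ M′ → FreeIn y M′ → FreeIn y M
FreeIn-⟶ (β {M} {N}) f with FreeIn-sub (single N) M f
... | zero  , g , h       = fappR h
... | suc v , g , fvar refl = fappL (flam g)
FreeIn-⟶ (appL s) (fappL f) = fappL (FreeIn-⟶ s f)
FreeIn-⟶ (appL s) (fappR f) = fappR f
FreeIn-⟶ (appR s) (fappL f) = fappL f
FreeIn-⟶ (appR s) (fappR f) = fappR (FreeIn-⟶ s f)
FreeIn-⟶ (ξ s)    (flam f)  = flam (FreeIn-⟶ s f)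

FreeIn-↠ : ∀ {y M M′} → M ↠ M′ → FreeIn y M′ → FreeIn y M
FreeIn-↠ ε       f = f
FreeIn-↠ (s ◅ r) f = FreeIn-⟶ s (FreeIn-↠ r f)

-- Confluence, via parallel reduction and complete developments

infix 4 _⇉_ _⇉*_
data _⇉_ : Λ → Λ → Set where
  pvar : ∀ {x} → var x ⇉ var x
  plam : ∀ {M M′} → M ⇉ M′ → lam M ⇉ lam M′
  papp : ∀ {M M′ N N′} → M ⇉ M′ → N ⇉ N′ → M · N ⇉ M′ · N′
  pβ   : ∀ {M M′ N N′} → M ⇉ M′ → N ⇉ N′ → lam M · N ⇉ M′ [ N′ ]

_⇉*_ : Λ → Λ → Set
_⇉*_ = Star _⇉_

⇉-refl : ∀ M → M ⇉ M
⇉-refl (var x) = pvar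
⇉-refl (M · N) = papp (⇉-refl M) (⇉-refl N)
⇉-refl (lam M) = plam (⇉-refl M)

⟶⇒⇉ : ∀ {M M′} → M ⟶ M′ → M ⇉ M′
⟶⇒⇉ (β {M} {N})       = pβ (⇉-refl M) (⇉-refl N)
⟶⇒⇉ (appL {N = N} s)  = papp (⟶⇒⇉ s) (⇉-refl N)
⟶⇒⇉ (appR {M = M} s)  = papp (⇉-refl M) (⟶⇒⇉ s)
⟶⇒⇉ (ξ s)             = plam (⟶⇒⇉ s)

⇉⇒↠ : ∀ {M M′} → M ⇉ M′ → M ↠ M′
⇉⇒↠ pvar       = ε
⇉⇒↠ (plam p)   = ξ* (⇉⇒↠ p)
⇉⇒↠ (papp p q) = appL* (⇉⇒↠ p) ◅◅ appR* (⇉⇒↠ q)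
⇉⇒↠ (pβ p q)   = appL* (ξ* (⇉⇒↠ p)) ◅◅ appR* (⇉⇒↠ q) ◅◅ (β ◅ ε)

ren-⇉ : ∀ ρ {M M′} → M ⇉ M′ → ren ρ M ⇉ ren ρ M′
ren-⇉ ρ pvar       = pvar
ren-⇉ ρ (plam p)   = plam (ren-⇉ (ext ρ) p)
ren-⇉ ρ (papp p q) = papp (ren-⇉ ρ p) (ren-⇉ ρ q)
ren-⇉ ρ (pβ {M} {M′} {N} {N′} p q) =
  subst (ren ρ (lam M · N) ⇉_) (sym (ren-[] ρ M′ N′)) (pβ (ren-⇉ (ext ρ) p) (ren-⇉ ρ q))

exts-⇉ : ∀ {σ τ} → (∀ y → σ y ⇉ τ y) → ∀ y → exts σ y ⇉ exts τ y
exts-⇉ e zero    = pvar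
exts-⇉ e (suc y) = ren-⇉ suc (e y)

sub-⇉ : ∀ {σ τ M M′} → (∀ y → σ y ⇉ τ y) → M ⇉ M′ → sub σ M ⇉ sub τ M′
sub-⇉ e (pvar {x}) = e x
sub-⇉ e (plam p)   = plam (sub-⇉ (exts-⇉ e) p)
sub-⇉ e (papp p q) = papp (sub-⇉ e p) (sub-⇉ e q)
sub-⇉ {σ} {τ} e (pβ {M} {M′} {N} {N′} p q) =
  subst (sub σ (lam M · N) ⇉_) (sym (sub-[] τ M′ N′)) (pβ (sub-⇉ (exts-⇉ e) p) (sub-⇉ e q))

single-⇉ : ∀ {N N′} → N ⇉ N′ → ∀ y → single N y ⇉ single N′ y
single-⇉ q zero    = q
single-⇉ q (suc y) = pvar

development : Λ → Λ
development (var x)           = var x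
development (lam M)           = lam (development M)
development (var x · N)       = var x · development N
development ((M₁ · M₂) · N)   = development (M₁ · M₂) · development N
development (lam M · N)       = development M [ development N ]

⇉-development : ∀ {M N} → M ⇉ N → N ⇉ development M
⇉-development pvar                     = pvar
⇉-development (plam p)                 = plam (⇉-development p)
⇉-development (papp {var x} pvar q)    = papp pvar (⇉-development q)
⇉-development (papp {M₁ · M₂} p q)     = papp (⇉-development p) (⇉-development q)
⇉-development (papp {lam M} (plam p) q) = pβ (⇉-development p) (⇉-development q)
⇉-development (pβ p q)                 = sub-⇉ (single-⇉ (⇉-development q)) (⇉-development p)

⇉-strip : ∀ {M N₁ N₂} → M ⇉ N₁ → M ⇉* N₂ → Σ Λ λ C → N₁ ⇉* C × N₂ ⇉ C
⇉-strip {N₁ = N₁} p ε = N₁ , ε , p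
⇉-strip p (q ◅ r) with ⇉-strip (⇉-development q) r
... | C , r′ , s = C , ⇉-development p ◅ r′ , s

⇉*-confluent : ∀ {M N₁ N₂} → M ⇉* N₁ → M ⇉* N₂ → Σ Λ λ C → N₁ ⇉* C × N₂ ⇉* C
⇉*-confluent {N₂ = N₂} ε r = N₂ , r , ε
⇉*-confluent (p ◅ r₁) r₂ with ⇉-strip p r₂
... | C , r′ , s with ⇉*-confluent r₁ r′
... | D , a , b = D , a , s ◅ b

↠⇒⇉* : ∀ {M N} → M ↠ N → M ⇉* N
↠⇒⇉* ε       = ε
↠⇒⇉* (s ◅ r) = ⟶⇒⇉ s ◅ ↠⇒⇉* r

⇉*⇒↠ : ∀ {M N} → M ⇉* N → M ↠ N
⇉*⇒↠ ε       = ε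
⇉*⇒↠ (p ◅ r) = ⇉⇒↠ p ◅◅ ⇉*⇒↠ r

confluence : ∀ {M N₁ N₂} → M ↠ N₁ → M ↠ N₂ → Σ Λ λ C → N₁ ↠ C × N₂ ↠ C
confluence r₁ r₂ with ⇉*-confluent (↠⇒⇉* r₁) (↠⇒⇉* r₂)
... | C , a , b = C , ⇉*⇒↠ a , ⇉*⇒↠ b

-- Standardisation and head normalisation

infix 4 _→w_ _→w*_ _⇒s_
data _→w_ : Λ → Λ → Set where
  wβ   : ∀ {M N} → lam M · N →w M [ N ]
  wapp : ∀ {M M′ N} → M →w M′ → M · N →w M′ · N

_→w*_ : Λ → Λ → Set
_→w*_ = Star _→w_

wapp* : ∀ {M M′ N} → M →w* M′ → M · N →w* M′ · N
wapp* ε       = ε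
wapp* (s ◅ r) = wapp s ◅ wapp* r

sub-→w : ∀ σ {M M′} → M →w M′ → sub σ M →w sub σ M′
sub-→w σ (wβ {M} {N}) = subst (sub σ (lam M · N) →w_) (sym (sub-[] σ M N)) wβ
sub-→w σ (wapp s)     = wapp (sub-→w σ s)

sub-→w* : ∀ σ {M M′} → M →w* M′ → sub σ M →w* sub σ M′
sub-→w* σ ε       = ε
sub-→w* σ (s ◅ r) = sub-→w σ s ◅ sub-→w* σ r

ren-→w* : ∀ ρ {M M′} → M →w* M′ → ren ρ M →w* ren ρ M′
ren-→w* ρ {M} {M′} r = subst₂ _→w*_ (sym (ren≡sub ρ M)) (sym (ren≡sub ρ M′)) (sub-→w* (var ∘ ρ) r)

data _⇒s_ : Λ → Λ → Set where
  svar : ∀ {M x} → M →w* var x → M ⇒s var x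
  sapp : ∀ {M P Q P′ Q′} → M →w* P · Q → P ⇒s P′ → Q ⇒s Q′ → M ⇒s P′ · Q′
  slam : ∀ {M P P′} → M →w* lam P → P ⇒s P′ → M ⇒s lam P′

⇒s-refl : ∀ M → M ⇒s M
⇒s-refl (var x) = svar ε
⇒s-refl (M · N) = sapp ε (⇒s-refl M) (⇒s-refl N)
⇒s-refl (lam M) = slam ε (⇒s-refl M)

→w*-⇒s : ∀ {M M′ N} → M →w* M′ → M′ ⇒s N → M ⇒s N
→w*-⇒s r (svar r′)     = svar (r ◅◅ r′)
→w*-⇒s r (sapp r′ p q) = sapp (r ◅◅ r′) p q
→w*-⇒s r (slam r′ p)   = slam (r ◅◅ r′) p

ren-⇒s : ∀ ρ {M N} → M ⇒s N → ren ρ M ⇒s ren ρ N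
ren-⇒s ρ (svar r)     = svar (ren-→w* ρ r)
ren-⇒s ρ (sapp r p q) = sapp (ren-→w* ρ r) (ren-⇒s ρ p) (ren-⇒s ρ q)
ren-⇒s ρ (slam r p)   = slam (ren-→w* ρ r) (ren-⇒s (ext ρ) p)

exts-⇒s : ∀ {σ τ} → (∀ y → σ y ⇒s τ y) → ∀ y → exts σ y ⇒s exts τ y
exts-⇒s e zero    = svar ε
exts-⇒s e (suc y) = ren-⇒s suc (e y)

sub-⇒s : ∀ {σ τ M N} → (∀ y → σ y ⇒s τ y) → M ⇒s N → sub σ M ⇒s sub τ N
sub-⇒s {σ} e (svar {x = x} r) = →w*-⇒s (sub-→w* σ r) (e x)
sub-⇒s {σ} e (sapp r p q)     = sapp (sub-→w* σ r) (sub-⇒s e p) (sub-⇒s e q)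
sub-⇒s {σ} e (slam r p)       = slam (sub-→w* σ r) (sub-⇒s (exts-⇒s e) p)

single-⇒s : ∀ {N N′} → N ⇒s N′ → ∀ y → single N y ⇒s single N′ y
single-⇒s q zero    = q
single-⇒s q (suc y) = svar ε

⇒s-⟶ : ∀ {M N N′} → M ⇒s N → N ⟶ N′ → M ⇒s N′
⇒s-⟶ (svar r) ()
⇒s-⟶ (sapp r p q) (appL s)          = sapp r (⇒s-⟶ p s) q
⇒s-⟶ (sapp r p q) (appR s)          = sapp r p (⇒s-⟶ q s)
⇒s-⟶ (sapp r (slam r′ p) q) β       = →w*-⇒s (r ◅◅ wapp* r′ ◅◅ (wβ ◅ ε)) (sub-⇒s (single-⇒s q) p)
⇒s-⟶ (slam r p) (ξ s)               = slam r (⇒s-⟶ p s)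

⇒s-↠ : ∀ {M N N′} → M ⇒s N → N ↠ N′ → M ⇒s N′
⇒s-↠ p ε       = p
⇒s-↠ p (s ◅ r) = ⇒s-↠ (⇒s-⟶ p s) r

standardisation : ∀ {M N} → M ↠ N → M ⇒s N
standardisation {M} = ⇒s-↠ (⇒s-refl M)

infix 4 _→h_ _→h*_
data _→h_ : Λ → Λ → Set where
  hlam : ∀ {M M′} → M →h M′ → lam M →h lam M′
  hw   : ∀ {M M′} → M →w M′ → M →h M′

_→h*_ : Λ → Λ → Set
_→h*_ = Star _→h_

hlam* : ∀ {M M′} → M →h* M′ → lam M →h* lam M′
hlam* ε       = ε
hlam* (s ◅ r) = hlam s ◅ hlam* r

hw* : ∀ {M M′} → M →w* M′ → M →h* M′
hw* ε       = ε
hw* (s ◅ r) = hw s ◅ hw* r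

→w⇒⟶ : ∀ {M M′} → M →w M′ → M ⟶ M′
→w⇒⟶ wβ       = β
→w⇒⟶ (wapp s) = appL (→w⇒⟶ s)

→h⇒⟶ : ∀ {M M′} → M →h M′ → M ⟶ M′
→h⇒⟶ (hlam s) = ξ (→h⇒⟶ s)
→h⇒⟶ (hw s)   = →w⇒⟶ s

→h*⇒↠ : ∀ {M M′} → M →h* M′ → M ↠ M′
→h*⇒↠ ε       = ε
→h*⇒↠ (s ◅ r) = →h⇒⟶ s ◅ →h*⇒↠ r

sub-→h : ∀ σ {M M′} → M →h M′ → sub σ M →h sub σ M′
sub-→h σ (hlam s) = hlam (sub-→h (exts σ) s)
sub-→h σ (hw s)   = hw (sub-→w σ s)

data Spine : Λ → Set where
  svar : ∀ {x} → Spine (var x)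
  sapp : ∀ {M N} → Spine M → Spine (M · N)

data Hnf : Λ → Set where
  hspine : ∀ {M} → Spine M → Hnf M
  hlam   : ∀ {M} → Hnf M → Hnf (lam M)

Spine-apps : ∀ {M} Ms → Spine M → Spine (apps M Ms)
Spine-apps []       s = s
Spine-apps (N ∷ Ms) s = Spine-apps Ms (sapp s)

Spine⇒apps : ∀ {M} → Spine M → Σ ℕ λ h → Σ (List Λ) λ Ms → M ≡ apps (var h) Ms
Spine⇒apps (svar {x}) = x , [] , refl
Spine⇒apps (sapp {N = N} s) with Spine⇒apps s
... | h , Ms , refl = h , Ms ++ N ∷ [] , sym (apps-∷ʳ (var h) Ms N)

Hnf⇒lams : ∀ {M} → Hnf M → Σ ℕ λ n → Σ ℕ λ h → Σ (List Λ) λ Ms → M ≡ lams n (apps (var h) Ms)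
Hnf⇒lams (hspine s) with Spine⇒apps s
... | h , Ms , e = 0 , h , Ms , e
Hnf⇒lams (hlam H) with Hnf⇒lams H
... | n , h , Ms , e = suc n , h , Ms , cong lam e

Hnf-lams : ∀ n h Ms → Hnf (lams n (apps (var h) Ms))
Hnf-lams zero    h Ms = hspine (Spine-apps Ms svar)
Hnf-lams (suc n) h Ms = hlam (Hnf-lams n h Ms)

HasHnf⇒↠Hnf : ∀ {M} → HasHnf M → Σ Λ λ H → M ↠ H × Hnf H
HasHnf⇒↠Hnf (n , h , Ms , r) = _ , r , Hnf-lams n h Ms

↠Hnf⇒HasHnf : ∀ {M H} → M ↠ H → Hnf H → HasHnf M
↠Hnf⇒HasHnf r hnf with Hnf⇒lams hnf
... | n , h , Ms , refl = n , h , Ms , r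

⇒s-Spine : ∀ {M N} → M ⇒s N → Spine N → Σ Λ λ N′ → M →w* N′ × Spine N′
⇒s-Spine (svar {x = x} r) svar = var x , r , svar
⇒s-Spine (sapp {Q = Q} r p q) (sapp s) with ⇒s-Spine p s
... | P′ , r′ , s′ = P′ · Q , r ◅◅ wapp* r′ , sapp s′

⇒s-Hnf : ∀ {M} n {N} → M ⇒s lams n N → Spine N → Σ Λ λ H → M →h* H × Hnf H
⇒s-Hnf zero p s with ⇒s-Spine p s
... | N′ , r , s′ = N′ , hw* r , hspine s′
⇒s-Hnf (suc n) (slam r p) s with ⇒s-Hnf n p s
... | H , r′ , hnf = lam H , hw* r ◅◅ hlam* r′ , hlam hnf

head-normalisation : ∀ {M} → HasHnf M → Σ Λ λ H → M →h* H × Hnf H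
head-normalisation (n , h , Ms , r) = ⇒s-Hnf n (standardisation r) (Spine-apps Ms svar)

Spine-→w-irreducible : ∀ {M M′} → Spine M → ¬ M →w M′
Spine-→w-irreducible (sapp ()) wβ
Spine-→w-irreducible (sapp s) (wapp t) = Spine-→w-irreducible s t

Hnf-→h-irreducible : ∀ {M M′} → Hnf M → ¬ M →h M′
Hnf-→h-irreducible (hspine s) (hw t)   = Spine-→w-irreducible s t
Hnf-→h-irreducible (hlam h)   (hlam t) = Hnf-→h-irreducible h t
Hnf-→h-irreducible (hlam h)   (hw ())

→w-deterministic : ∀ {M M₁ M₂} → M →w M₁ → M →w M₂ → M₁ ≡ M₂
→w-deterministic wβ       wβ       = refl
→w-deterministic wβ       (wapp ())
→w-deterministic (wapp ()) wβ
→w-deterministic (wapp s) (wapp t) = cong (_· _) (→w-deterministic s t)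

→h-deterministic : ∀ {M M₁ M₂} → M →h M₁ → M →h M₂ → M₁ ≡ M₂
→h-deterministic (hlam s) (hlam t) = cong lam (→h-deterministic s t)
→h-deterministic (hlam s) (hw ())
→h-deterministic (hw ())  (hlam t)
→h-deterministic (hw s)   (hw t)   = →w-deterministic s t

→w-progress : ∀ M → Spine M ⊎ (Σ Λ λ P → M ≡ lam P) ⊎ (Σ Λ λ M′ → M →w M′)
→w-progress (var x) = inj₁ svar
→w-progress (lam M) = inj₂ (inj₁ (M , refl))
→w-progress (M · N) with →w-progress M
... | inj₁ s                  = inj₁ (sapp s)
... | inj₂ (inj₁ (P , refl))  = inj₂ (inj₂ (P [ N ] , wβ))
... | inj₂ (inj₂ (M′ , s))    = inj₂ (inj₂ (M′ · N , wapp s))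

→h-progress : ∀ M → Hnf M ⊎ (Σ Λ λ M′ → M →h M′)
→h-progress (var x) = inj₁ (hspine svar)
→h-progress (lam M) with →h-progress M
... | inj₁ h        = inj₁ (hlam h)
... | inj₂ (M′ , s) = inj₂ (lam M′ , hlam s)
→h-progress (M · N) with →w-progress (M · N)
... | inj₁ s                = inj₁ (hspine s)
... | inj₂ (inj₂ (M′ , s))  = inj₂ (M′ , hw s)

-- Head reduction commutes with substitution and is deterministic, so while M is
-- not in hnf its head steps are steps of the head reduction of sub σ M.
sub-→h*-Hnf⁻ : ∀ σ {P H} → P →h* H → Hnf H → ∀ M → P ≡ sub σ M → Σ Λ λ H′ → M ↠ H′ × Hnf H′
sub-→h*-Hnf⁻ σ r hnf M e with →h-progress M
... | inj₁ h = M , ε , h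
sub-→h*-Hnf⁻ σ ε hnf M refl | inj₂ (M′ , s) = ⊥-elim (Hnf-→h-irreducible hnf (sub-→h σ s))
sub-→h*-Hnf⁻ σ (t ◅ r) hnf M refl | inj₂ (M′ , s) with
  sub-→h*-Hnf⁻ σ r hnf M′ (→h-deterministic t (sub-→h σ s))
... | H′ , r′ , h′ = H′ , →h⇒⟶ s ◅ r′ , h′

HasHnf-sub⁻ : ∀ σ M → HasHnf (sub σ M) → HasHnf M
HasHnf-sub⁻ σ M hh with head-normalisation hh
... | H , r , hnf with sub-→h*-Hnf⁻ σ r hnf M refl
... | H′ , r′ , hnf′ = ↠Hnf⇒HasHnf r′ hnf′

-- Reducts of head normal forms

lam-↠⁻ : ∀ {M N} → lam M ↠ N → Σ Λ λ M′ → N ≡ lam M′ × M ↠ M′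
lam-↠⁻ {M} ε   = M , refl , ε
lam-↠⁻ (ξ s ◅ r) with lam-↠⁻ r
... | M′ , e , r′ = M′ , e , s ◅ r′

lams-↠⁻ : ∀ n {M N} → lams n M ↠ N → Σ Λ λ M′ → N ≡ lams n M′ × M ↠ M′
lams-↠⁻ zero {N = N} r = N , refl , r
lams-↠⁻ (suc n) r with lam-↠⁻ r
... | _ , refl , r′ with lams-↠⁻ n r′
... | M′ , refl , r″ = M′ , refl , r″

infix 4 _↠spine_
data _↠spine_ : Λ → Λ → Set where
  svar : ∀ {h} → var h ↠spine var h
  sapp : ∀ {P P′ Q Q′} → P ↠spine P′ → Q ↠ Q′ → P · Q ↠spine P′ · Q′

↠spine-⟶ : ∀ {M N N′} → M ↠spine N → N ⟶ N′ → M ↠spine N′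
↠spine-⟶ (sapp () q) β
↠spine-⟶ (sapp p q) (appL s) = sapp (↠spine-⟶ p s) q
↠spine-⟶ (sapp p q) (appR s) = sapp p (q ◅◅ (s ◅ ε))

↠spine-↠ : ∀ {M N N′} → M ↠spine N → N ↠ N′ → M ↠spine N′
↠spine-↠ p ε       = p
↠spine-↠ p (s ◅ r) = ↠spine-↠ (↠spine-⟶ p s) r

↠spine-refl : ∀ {M} → Spine M → M ↠spine M
↠spine-refl svar     = svar
↠spine-refl (sapp s) = sapp (↠spine-refl s) ε

↠spine-apps⁻ : ∀ Ns {M N} → apps M Ns ↠spine N →
  Σ Λ λ M′ → Σ (List Λ) λ Ns′ → N ≡ apps M′ Ns′ × M ↠spine M′ × Pointwise _↠_ Ns Ns′
↠spine-apps⁻ []       {N = N} p = N , [] , refl , p , []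
↠spine-apps⁻ (_ ∷ Ns) p with ↠spine-apps⁻ Ns p
... | _ , Ns′ , refl , sapp {P′ = P′} {Q′ = Q′} p′ q , rs = P′ , Q′ ∷ Ns′ , refl , p′ , q ∷ rs

var-apps-↠⁻ : ∀ h Ns {N} → apps (var h) Ns ↠ N →
  Σ (List Λ) λ Ns′ → N ≡ apps (var h) Ns′ × Pointwise _↠_ Ns Ns′
var-apps-↠⁻ h Ns r with ↠spine-apps⁻ Ns (↠spine-↠ (↠spine-refl (Spine-apps Ns svar)) r)
... | _ , Ns′ , e , svar , rs = Ns′ , e , rs

hnf-↠⁻ : ∀ n h Ns {N} → lams n (apps (var h) Ns) ↠ N →
  Σ (List Λ) λ Ns′ → N ≡ lams n (apps (var h) Ns′) × Pointwise _↠_ Ns Ns′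
hnf-↠⁻ n h Ns r with lams-↠⁻ n r
... | _ , refl , r′ with var-apps-↠⁻ h Ns r′
... | Ns′ , refl , rs = Ns′ , refl , rs

var·-↠⁻ : ∀ {x Q N} → var x · Q ↠ N → Σ Λ λ Q′ → N ≡ var x · Q′ × Q ↠ Q′
var·-↠⁻ {Q = Q} ε = Q , refl , ε
var·-↠⁻ (appR s ◅ r) with var·-↠⁻ r
... | Q′ , e , r′ = Q′ , e , s ◅ r′

·var-↠⁻ : ∀ {M x N} → M · var x ↠ N →
  (Σ Λ λ M′ → M ↠ M′ × N ≡ M′ · var x) ⊎ (Σ Λ λ Q → M ↠ lam Q × Q [ var x ] ↠ N)
·var-↠⁻ {M} ε   = inj₁ (M , ε , refl)
·var-↠⁻ (β {Q} ◅ r) = inj₂ (Q , ε , r)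
·var-↠⁻ (appL s ◅ r) with ·var-↠⁻ r
... | inj₁ (M′ , a , e) = inj₁ (M′ , s ◅ a , e)
... | inj₂ (Q , a , b)  = inj₂ (Q , s ◅ a , b)
·var-↠⁻ (appR () ◅ r)

nargs : Λ → ℕ
nargs (M · N) = suc (nargs M)
nargs (var x) = 0
nargs (lam M) = 0

nargs-apps : ∀ M Ms → nargs (apps M Ms) ≡ nargs M + length Ms
nargs-apps M []       = sym (+-identityʳ (nargs M))
nargs-apps M (N ∷ Ms) = trans (nargs-apps (M · N) Ms) (sym (+-suc (nargs M) (length Ms)))

apps-injective : ∀ {M N} Ms Ns → length Ms ≡ length Ns → apps M Ms ≡ apps N Ns → M ≡ N × Ms ≡ Ns
apps-injective []       []       _ e = e , refl
apps-injective (_ ∷ Ms) (_ ∷ Ns) l e with apps-injective Ms Ns (suc-injective l) e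
... | refl , refl = refl , refl

var-apps-injective : ∀ {h h′} Ms Ns → apps (var h) Ms ≡ apps (var h′) Ns → h ≡ h′ × Ms ≡ Ns
var-apps-injective {h} {h′} Ms Ns e
  with apps-injective Ms Ns (trans (sym (nargs-apps (var h) Ms)) (trans (cong nargs e) (nargs-apps (var h′) Ns))) e
... | refl , refl = refl , refl

Spine≢lam : ∀ {M N} → Spine M → M ≢ lam N
Spine≢lam svar     ()
Spine≢lam (sapp s) ()

lams-injective : ∀ n n′ {M M′} → Spine M → Spine M′ → lams n M ≡ lams n′ M′ → n ≡ n′ × M ≡ M′
lams-injective zero    zero     s s′ e = refl , e
lams-injective zero    (suc n′) s s′ e = ⊥-elim (Spine≢lam s e)
lams-injective (suc n) zero     s s′ e = ⊥-elim (Spine≢lam s′ (sym e))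
lams-injective (suc n) (suc n′) s s′ e with lams-injective n n′ s s′ (lam-injective e)
  where lam-injective : ∀ {M N} → lam M ≡ lam N → M ≡ N
        lam-injective refl = refl
... | refl , refl = refl , refl

hnf-injective : ∀ {n n′ h h′} Ms Ns → lams n (apps (var h) Ms) ≡ lams n′ (apps (var h′) Ns) →
  n ≡ n′ × h ≡ h′ × Ms ≡ Ns
hnf-injective {n} {n′} Ms Ns e with lams-injective n n′ (Spine-apps Ms svar) (Spine-apps Ns svar) e
... | refl , e′ with var-apps-injective Ms Ns e′
... | refl , refl = refl , refl , refl

-- Böhm-tree equality

BTeq-sym : ∀ k {M N} → BTeq k M N → BTeq k N M
BTeq-sym zero    _                 = tt
BTeq-sym (suc k) (inj₁ (m⊥ , n⊥)) = inj₁ (n⊥ , m⊥)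
BTeq-sym (suc k) (inj₂ (n , h , Ms , Ns , rM , rN , bs)) =
  inj₂ (n , h , Ns , Ms , rN , rM , Pw.symmetric (BTeq-sym k) bs)

=∞-sym : ∀ {M N} → M =∞ N → N =∞ M
=∞-sym b k = BTeq-sym k (b k)

BTeq-var : ∀ k x → BTeq k (var x) (var x)
BTeq-var zero    x = tt
BTeq-var (suc k) x = inj₂ (0 , x , [] , [] , ε , ε , [])

Unfolds : ℕ → ℕ → Λ → Set
Unfolds zero    x M = ⊤
Unfolds (suc k) x M = Σ Λ λ M′ → M ↠ var x · M′ × Unfolds k x M′

↠-Unfolds : ∀ k {x M M′} → M ↠ M′ → Unfolds k x M′ → Unfolds k x M
↠-Unfolds zero    r _              = tt
↠-Unfolds (suc k) r (M₁ , r₁ , u) = M₁ , r ◅◅ r₁ , u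

Unfolds-↠ : ∀ k {x M M′} → M ↠ M′ → Unfolds k x M → Unfolds k x M′
Unfolds-↠ zero    r _ = tt
Unfolds-↠ (suc k) r (M₁ , r₁ , u) with confluence r₁ r
... | _ , a , b with var·-↠⁻ a
... | M₂ , refl , r₂ = M₂ , b , Unfolds-↠ k r₂ u

ren-Unfolds : ∀ k ρ {x M} → Unfolds k x M → Unfolds k (ρ x) (ren ρ M)
ren-Unfolds zero    ρ _              = tt
ren-Unfolds (suc k) ρ (M₁ , r , u) = ren ρ M₁ , ren-↠ ρ r , ren-Unfolds k ρ u

Unfolds-pred : ∀ k {x M} → Unfolds (suc k) x M → Unfolds k x M
Unfolds-pred zero    _            = tt
Unfolds-pred (suc k) (M₁ , r , u) = M₁ , r , Unfolds-pred k u

Unfolds-var· : ∀ k {x M} → Unfolds k x M → Unfolds k x (var x · M)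
Unfolds-var· zero    _ = tt
Unfolds-var· (suc k) {M = M} u = M , ε , Unfolds-pred k u

Unfolds⇒BTeq : ∀ k {x M N} → Unfolds k x M → Unfolds k x N → BTeq k M N
Unfolds⇒BTeq zero    _ _ = tt
Unfolds⇒BTeq (suc k) {x} (M₁ , rM , uM) (N₁ , rN , uN) =
  inj₂ (0 , x , M₁ ∷ [] , N₁ ∷ [] , rM , rN , Unfolds⇒BTeq k uM uN ∷ [])

BTeq-Unfolds : ∀ k {x M N} → BTeq k M N → Unfolds k x N → Unfolds k x M
BTeq-Unfolds zero _ _ = tt
BTeq-Unfolds (suc k) {x} (inj₁ (_ , n⊥)) (N₁ , r , _) = ⊥-elim (n⊥ (0 , x , N₁ ∷ [] , r))
BTeq-Unfolds (suc k) {x} (inj₂ (n , h , Ms , Ns , rM , rN , bs)) (N₁ , r , u)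
  with confluence rN r
... | _ , a , b with hnf-↠⁻ n h Ns a | var·-↠⁻ b
... | Ns′ , refl , rs | N₂ , e , r₂ with hnf-injective {n} {0} Ns′ (N₂ ∷ []) e
BTeq-Unfolds (suc k) (inj₂ (_ , _ , M₁ ∷ [] , _ ∷ [] , rM , _ , b ∷ [])) (N₁ , r , u)
  | _ , a , b′ | _ , refl , r₁ ∷ [] | N₂ , e , r₂ | refl , refl , refl =
  M₁ , rM , BTeq-Unfolds k b (↠-Unfolds k r₁ (Unfolds-↠ k r₂ u))

IdExcept : ℕ → (ℕ → Λ) → Set
IdExcept z σ = ∀ y → y ≢ z → σ y ≡ var y

IdExcept-exts : ∀ {z σ} → IdExcept z σ → IdExcept (suc z) (exts σ)
IdExcept-exts id zero    _  = refl
IdExcept-exts id (suc y) ne = cong (ren suc) (id y (ne ∘ cong suc))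

IdExcept-extsⁿ : ∀ n {z σ} → IdExcept z σ → IdExcept (n + z) (extsⁿ n σ)
IdExcept-extsⁿ zero    id = id
IdExcept-extsⁿ (suc n) {z} {σ} id =
  subst (λ w → IdExcept w (extsⁿ (suc n) σ)) (+-suc n z) (IdExcept-extsⁿ n (IdExcept-exts id))

sub-IdExcept : ∀ {z σ} M → IdExcept z σ → ¬ FreeIn z M → sub σ M ≡ M
sub-IdExcept {z} M id z∉M =
  trans (sub-cong-FreeIn M (λ y f → id y (λ { refl → z∉M f }))) (sub-id M)

-- The head variable of N, hence of M, is not z, so σ leaves it unchanged.
BTeq-sub-IdExcept : ∀ k {z σ M N} → IdExcept z σ → ¬ FreeIn z N → BTeq k M N → BTeq k (sub σ M) N
BTeq-sub-IdExcept* : ∀ k {z σ Ms Ns} → IdExcept z σ → All (λ N → ¬ FreeIn z N) Ns →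
  Pointwise (BTeq k) Ms Ns → Pointwise (BTeq k) (map (sub σ) Ms) Ns
BTeq-sub-IdExcept zero _ _ _ = tt
BTeq-sub-IdExcept (suc k) {σ = σ} {M} _ _ (inj₁ (m⊥ , n⊥)) = inj₁ (m⊥ ∘ HasHnf-sub⁻ σ M , n⊥)
BTeq-sub-IdExcept (suc k) {z} {σ} {M} id z∉N (inj₂ (n , h , Ms , Ns , rM , rN , bs))
  with ¬FreeIn-apps⁻ (var h) Ns (z∉N ∘ FreeIn-↠ rN ∘ FreeIn-lams n)
... | z∉h , z∉Ns = inj₂ (n , h , map (sub (extsⁿ n σ)) Ms , Ns ,
        subst (sub σ M ↠_) (sub-hnf σ n h Ms (IdExcept-extsⁿ n id h (λ { refl → z∉h (fvar refl) })))
              (sub-↠ σ rM) ,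
        rN , BTeq-sub-IdExcept* k (IdExcept-extsⁿ n id) z∉Ns bs)
BTeq-sub-IdExcept* k id []            []       = []
BTeq-sub-IdExcept* k id (z∉N ∷ z∉Ns) (b ∷ bs) =
  BTeq-sub-IdExcept k id z∉N b ∷ BTeq-sub-IdExcept* k id z∉Ns bs

VarSubst : (ℕ → Λ) → Set
VarSubst σ = ∀ y → Σ ℕ λ v → σ y ≡ var v

VarSubst-exts : ∀ {σ} → VarSubst σ → VarSubst (exts σ)
VarSubst-exts vs zero = zero , refl
VarSubst-exts vs (suc y) with vs y
... | v , e = suc v , cong (ren suc) e

VarSubst-extsⁿ : ∀ n {σ} → VarSubst σ → VarSubst (extsⁿ n σ)
VarSubst-extsⁿ zero    vs = vs
VarSubst-extsⁿ (suc n) vs = VarSubst-extsⁿ n (VarSubst-exts vs)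

VarSubst-single : ∀ x → VarSubst (single (var x))
VarSubst-single x zero    = x , refl
VarSubst-single x (suc y) = y , refl

BTeq-sub-VarSubst : ∀ k {σ M N} → VarSubst σ → BTeq k M N → BTeq k (sub σ M) (sub σ N)
BTeq-sub-VarSubst zero _ _ = tt
BTeq-sub-VarSubst (suc k) {σ} {M} {N} _ (inj₁ (m⊥ , n⊥)) =
  inj₁ (m⊥ ∘ HasHnf-sub⁻ σ M , n⊥ ∘ HasHnf-sub⁻ σ N)
BTeq-sub-VarSubst (suc k) {σ} {M} {N} vs (inj₂ (n , h , Ms , Ns , rM , rN , bs))
  with VarSubst-extsⁿ n vs h
... | v , e = inj₂ (n , v , map (sub (extsⁿ n σ)) Ms , map (sub (extsⁿ n σ)) Ns ,
        subst (sub σ M ↠_) (sub-hnf σ n h Ms e) (sub-↠ σ rM) ,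
        subst (sub σ N ↠_) (sub-hnf σ n h Ns e) (sub-↠ σ rN) ,
        Pw.map⁺ _ _ (Pw.map (BTeq-sub-VarSubst k (VarSubst-extsⁿ n vs)) bs))

¬HasHnf-·var : ∀ {M x} → ¬ HasHnf M → ¬ HasHnf (M · var x)
¬HasHnf-·var {M} {x} m⊥ hnf with HasHnf⇒↠Hnf hnf
... | H , r , h with ·var-↠⁻ r
... | inj₁ (M′ , a , refl) with h
... | hspine (sapp s) = m⊥ (↠Hnf⇒HasHnf a (hspine s))
¬HasHnf-·var {M} {x} m⊥ hnf | H , r , h | inj₂ (Q , a , b)
  with HasHnf⇒↠Hnf (HasHnf-sub⁻ (single (var x)) Q (↠Hnf⇒HasHnf b h))
... | H′ , r′ , h′ = m⊥ (↠Hnf⇒HasHnf (a ◅◅ ξ* r′) (hlam h′))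

BTeq-·var : ∀ k {M N} x → BTeq k M N → BTeq k (M · var x) (N · var x)
BTeq-·var zero x _ = tt
BTeq-·var (suc k) x (inj₁ (m⊥ , n⊥)) = inj₁ (¬HasHnf-·var m⊥ , ¬HasHnf-·var n⊥)
BTeq-·var (suc k) x (inj₂ (zero , h , Ms , Ns , rM , rN , bs)) =
  inj₂ (0 , h , Ms ++ var x ∷ [] , Ns ++ var x ∷ [] ,
    subst (_ ↠_) (sym (apps-∷ʳ (var h) Ms (var x))) (appL* rM) ,
    subst (_ ↠_) (sym (apps-∷ʳ (var h) Ns (var x))) (appL* rN) ,
    ++⁺ bs (BTeq-var k x ∷ []))
BTeq-·var (suc k) {M} {N} x (inj₂ (suc n , h , Ms , Ns , rM , rN , bs))
  with VarSubst-extsⁿ n (VarSubst-single x) h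
... | v , e = inj₂ (n , v , map (sub τ) Ms , map (sub τ) Ns ,
    subst (M · var x ↠_) (sub-hnf (single (var x)) n h Ms e) (appL* rM ◅◅ (β ◅ ε)) ,
    subst (N · var x ↠_) (sub-hnf (single (var x)) n h Ns e) (appL* rN ◅◅ (β ◅ ε)) ,
    Pw.map⁺ _ _ (Pw.map (BTeq-sub-VarSubst k (VarSubst-extsⁿ n (VarSubst-single x))) bs))
  where τ = extsⁿ n (single (var x))

-- Weak fixed point combinators

A₀ : Λ
A₀ = lam (lam (var 0 · (var 1 · var 1 · var 0)))

Θ : Λ
Θ = A₀ · A₀

Θ-↠ : ∀ M → Θ · M ↠ M · (Θ · M)
Θ-↠ M = appL β ◅ β ◅ ε

Θ-↠hnf : Θ ↠ lam (var 0 · (Θ · var 0))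
Θ-↠hnf = β ◅ ε

Θ-↠iter : ∀ G m → Θ · G ↠ iter G m (Θ · G)
Θ-↠iter G zero    = ε
Θ-↠iter G (suc m) = Θ-↠ G ◅◅ appR* (Θ-↠iter G m)

A₀-closed : ∀ z → ¬ FreeIn z A₀
A₀-closed z (flam (flam (fappL (fvar ()))))
A₀-closed z (flam (flam (fappR (fappL (fappL (fvar ()))))))
A₀-closed z (flam (flam (fappR (fappL (fappR (fvar ()))))))
A₀-closed z (flam (flam (fappR (fappR (fvar ())))))

Θ-closed : ∀ z → ¬ FreeIn z Θ
Θ-closed z (fappL f) = A₀-closed z f
Θ-closed z (fappR f) = A₀-closed z f

Θ·var-Unfolds : ∀ k x → Unfolds k x (Θ · var x)
Θ·var-Unfolds zero    x = tt
Θ·var-Unfolds (suc k) x = Θ · var x , Θ-↠ (var x) , Θ·var-Unfolds k x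

wfpc⇒Unfolds : ∀ {Y} → IsWFPC Y → ∀ {x} → ¬ FreeIn x Y → ∀ k → Unfolds k x (Y · var x)
wfpc⇒Unfolds wf x∉Y zero = tt
wfpc⇒Unfolds {Y} wf {x} x∉Y (suc k) =
  BTeq-Unfolds (suc k) (wf x x∉Y (suc k)) (Y · var x , ε , wfpc⇒Unfolds wf x∉Y k)

Unfolds⇒wfpc : ∀ {Y} → (∀ x → ¬ FreeIn x Y → ∀ k → Unfolds k x (Y · var x)) → IsWFPC Y
Unfolds⇒wfpc u x x∉Y k = Unfolds⇒BTeq k (u x x∉Y k) (Unfolds-var· k (u x x∉Y k))

Θ-wfpc : IsWFPC Θ
Θ-wfpc = Unfolds⇒wfpc (λ x _ k → Θ·var-Unfolds k x)

BTeq-Unfolds-·var : ∀ k x {M N} → BTeq k M N → Unfolds k x (N · var x) → Unfolds k x (M · var x)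
BTeq-Unfolds-·var k x b = BTeq-Unfolds k (BTeq-·var k x b)

fresh : Λ → ℕ
fresh (var x) = suc x
fresh (M · N) = fresh M ⊔ fresh N
fresh (lam M) = pred (fresh M)

FreeIn⇒<fresh : ∀ {y} M → FreeIn y M → y < fresh M
FreeIn⇒<fresh (var x) (fvar refl) = s≤s ≤-refl
FreeIn⇒<fresh (M · N) (fappL f)   = ≤-trans (FreeIn⇒<fresh M f) (m≤m⊔n (fresh M) (fresh N))
FreeIn⇒<fresh (M · N) (fappR f)   = ≤-trans (FreeIn⇒<fresh N f) (m≤n⊔m (fresh M) (fresh N))
FreeIn⇒<fresh (lam M) (flam f) with fresh M | FreeIn⇒<fresh M f
... | suc _ | s≤s y<b = y<b

fresh-∉ : ∀ M → ¬ FreeIn (fresh M) M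
fresh-∉ M f = <-irrefl refl (FreeIn⇒<fresh M f)

abstractρ : ℕ → ℕ → ℕ
abstractρ x y with y ≟ x
... | yes _ = 0
... | no  _ = suc y

abstractρ-same : ∀ x → abstractρ x x ≡ 0
abstractρ-same x with x ≟ x
... | yes _ = refl
... | no x≢x = ⊥-elim (x≢x refl)

abstractρ-other : ∀ x y → y ≢ x → abstractρ x y ≡ suc y
abstractρ-other x y y≢x with y ≟ x
... | yes y≡x = ⊥-elim (y≢x y≡x)
... | no  _   = refl

ren-abstractρ-[] : ∀ x Q → ¬ FreeIn x (lam Q) → ren (abstractρ x) (Q [ var x ]) ≡ Q
ren-abstractρ-[] x Q x∉ = trans (sub-ren (abstractρ x) (single (var x)) Q)
  (trans (sub-cong-FreeIn Q (λ { zero    _ → cong var (abstractρ-same x)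
                               ; (suc y) f → cong var (abstractρ-other x y (λ { refl → x∉ (flam f) })) }))
         (sub-id Q))

-- For fresh x, the first unfolding of Y x cannot come from Y ↠ x, so Y ↠ λQ.
wfpc-↠lam : ∀ {Y} → IsWFPC Y → Σ Λ λ Q → Y ↠ lam Q × ∀ k → Unfolds k 0 Q
wfpc-↠lam {Y} wf with wfpc⇒Unfolds wf (fresh-∉ Y) 1
... | _ , r , _ with ·var-↠⁻ r
... | inj₁ (_ , a , refl) = ⊥-elim (fresh-∉ Y (FreeIn-↠ a (fvar refl)))
... | inj₂ (Q , a , _) = Q , a , λ k →
  subst₂ (Unfolds k) (abstractρ-same x) (ren-abstractρ-[] x Q (fresh-∉ Y ∘ FreeIn-↠ a))
    (ren-Unfolds k (abstractρ x) (Unfolds-↠ k (appL* a ◅◅ (β ◅ ε)) (wfpc⇒Unfolds wf (fresh-∉ Y) k)))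
  where x = fresh Y

wfpc⇒=∞Θ : ∀ {Y} → IsWFPC Y → Y =∞ Θ
wfpc⇒=∞Θ wf zero = tt
wfpc⇒=∞Θ wf (suc k) with wfpc-↠lam wf
... | Q , r , u with u (suc k)
... | R , rQ , uR = inj₂ (1 , 0 , R ∷ [] , Θ · var 0 ∷ [] , r ◅◅ ξ* rQ , Θ-↠hnf ,
                          Unfolds⇒BTeq k uR (Θ·var-Unfolds k 0) ∷ [])

infix 6 _↦_
_↦_ : ℕ → Λ → ℕ → Λ
(z ↦ P) y with y ≟ z
... | yes _ = P
... | no  _ = var y

↦-same : ∀ z P → (z ↦ P) z ≡ P
↦-same z P with z ≟ z
... | yes _   = refl
... | no  z≢z = ⊥-elim (z≢z refl)

↦-IdExcept : ∀ z P → IdExcept z (z ↦ P)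
↦-IdExcept z P y y≢z with y ≟ z
... | yes y≡z = ⊥-elim (y≢z y≡z)
... | no  _   = refl

sub-↦-iter : ∀ {z P} G m → ¬ FreeIn z G → sub (z ↦ P) (iter G m (var z)) ≡ iter G m P
sub-↦-iter {z} {P} G zero    z∉G = ↦-same z P
sub-↦-iter {z} {P} G (suc m) z∉G = cong₂ _·_ (sub-IdExcept G (↦-IdExcept z P) z∉G) (sub-↦-iter G m z∉G)

var-apps-∉∞ : ∀ {z} Gs → ¬ z ∉∞ apps (var z) Gs
var-apps-∉∞ {z} Gs (N , N=A , z∉N) with N=A 1
... | inj₁ (_ , a⊥) = a⊥ (0 , z , Gs , ε)
... | inj₂ (n , h , Ns , Ms , rN , rA , _) with var-apps-↠⁻ z Gs rA
... | Gs′ , e , _ with hnf-injective {n} {0} Ms Gs′ e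
... | refl , refl , _ = proj₁ (¬FreeIn-apps⁻ (var z) Ns (z∉N ∘ FreeIn-↠ rN)) (fvar refl)

weaklyCompact⇒weaklyConstant : ∀ z G₀ Gs → WeaklyCompact z G₀ Gs → WeaklyConstant z G₀ Gs
weaklyCompact⇒weaklyConstant z G₀ Gs (k , wf) = k , Θ , =∞-sym (wfpc⇒=∞Θ wf) , Θ-closed z

weaklyConstant⇒weaklyCompact : ∀ {z G₀ Gs} → IsWFGV G₀ Gs → All (λ G → ¬ FreeIn z G) (G₀ ∷ Gs) →
  WeaklyConstant z G₀ Gs → WeaklyCompact z G₀ Gs
weaklyConstant⇒weaklyCompact {Gs = Gs} _ _ (zero , z∉∞A) = ⊥-elim (var-apps-∉∞ Gs z∉∞A)
weaklyConstant⇒weaklyCompact {z} {G₀} {Gs} wfgv (z∉G₀ ∷ z∉Gs) (suc k , N , N=A , z∉N) =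
  suc k , Unfolds⇒wfpc Ax-Unfolds
  where
  A = apps (iter G₀ (suc k) (var z)) Gs
  σ = z ↦ Θ · G₀
  Y = apps (Θ · G₀) Gs

  Y↠Aσ : Y ↠ sub σ A
  Y↠Aσ = subst (Y ↠_)
    (sym (trans (sub-apps σ _ Gs)
                (cong₂ apps (sub-↦-iter G₀ (suc k) z∉G₀)
                            (map-id-local (All.map (λ {G} → sub-IdExcept G (↦-IdExcept z _)) z∉Gs)))))
    (apps* Gs (Θ-↠iter G₀ (suc k)))

  N=Aσ : N =∞ sub σ A
  N=Aσ = =∞-sym (λ j → BTeq-sub-IdExcept j (↦-IdExcept z _) z∉N (BTeq-sym j (N=A j)))

  Ax-Unfolds : ∀ x → ¬ FreeIn x A → ∀ j → Unfolds j x (A · var x)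
  Ax-Unfolds x x∉A j =
    BTeq-Unfolds-·var j x (BTeq-sym j (N=A j))
      (BTeq-Unfolds-·var j x (N=Aσ j)
        (Unfolds-↠ j (appL* Y↠Aσ) (wfpc⇒Unfolds (wfgv Θ Θ-wfpc) x∉Y j)))
    where
    x∉iter×x∉Gs = ¬FreeIn-apps⁻ (iter G₀ (suc k) (var z)) Gs x∉A
    x∉Y : ¬ FreeIn x Y
    x∉Y = ¬FreeIn-apps⁺ (Θ · G₀) Gs
      (λ { (fappL f) → Θ-closed x f ; (fappR f) → proj₁ x∉iter×x∉Gs (fappL f) })
      (proj₂ x∉iter×x∉Gs)

proposition4p7 : (G₀ : Λ) (Gs : List Λ) → IsWFGV G₀ Gs →
    (z : ℕ) → All (λ G → ¬ FreeIn z G) (G₀ ∷ Gs) →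
    WeaklyConstant z G₀ Gs ⇔ WeaklyCompact z G₀ Gs
proposition4p7 G₀ Gs wfgv z z∉G⃗ =
  mk⇔ (weaklyConstant⇒weaklyCompact wfgv z∉G⃗) (weaklyCompact⇒weaklyConstant z G₀ Gs)
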